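{- For all $\sigma,\tau\in\omega^{<\omega}$ with $J^\omega(\sigma)\neq\langle\rangle$: $J^\omega(\sigma)\subseteq J^\omega(\tau)$ if and only if $J^n(\sigma)\subseteq J^n(\tau)$ for all $n<\omega$.
   Context: $\subseteq$ is the prefix relation on finite strings, $\langle\rangle$ the empty string. Fix an effective enumeration $\varphi_0,\varphi_1,\dots$ of Turing functionals; for a finite string $\sigma$, $\varphi_e^\sigma(i)\downarrow$ means convergence with oracle $\sigma$ within $|\sigma|$ steps. Finite strings are identified with natural numbers via a fixed computable coding. The jump approximation function $J:\omega^{<\omega}\to\omega^{<\omega}$: given $\sigma$, let $t_{ -1}=1$ and for $i\ge0$ let $t_i=t_{i-1}+1$ if $\varphi_i^\sigma(i)\uparrow$, and $t_i=\max\{t_{i-1}+1,\ \mu t\,(\varphi_i^{\sigma\restriction t}(i)\downarrow)\}$ otherwise; then $J(\sigma)=\langle\sigma\restriction t_0,\dots,\sigma\restriction t_k\rangle$ where $k$ is least with $t_{k+1}>|\sigma|$ ($J(\sigma)=\langle\rangle$ if $t_0>|\sigma|$). $J^n$ is the $n$-fold iterate of $J$ ($J^0$ the identity). The $\omega$-jump approximation is $J^\omega(\sigma)=\langle J^1(\sigma)(0),J^2(\sigma)(0),\dots,J^n(\sigma)(0)\rangle$ where $n$ is least with $J^{n+1}(\sigma)=\langle\rangle$. -}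

module Defs where

open import Data.Nat using (ℕ; zero; suc; _+_; _⊔_; _≤ᵇ_)
open import Data.Bool using (Bool; true; false; if_then_else_)
open import Data.List using (List; []; _∷_; take; length)
open import Data.List.Relation.Binary.Prefix.Heterogeneous using (Prefix)
open import Relation.Binary.PropositionalEquality using (_≡_)
open import Function using (Injective)

_⊑_ : List ℕ → List ℕ → Set
_⊑_ = Prefix _≡_

-- Φ e ρ = true  means  φ_e^ρ(e)↓ within |ρ| steps (with oracle the finite string ρ).
-- Property of any step-bounded oracle computation: convergence persists
-- when the oracle string is extended (and hence more steps are allowed).
Monotone : (ℕ → List ℕ → Bool) → Set
Monotone Φ = ∀ e ρ ρ′ → ρ ⊑ ρ′ → Φ e ρ ≡ true → Φ e ρ′ ≡ true

Coding : (List ℕ → ℕ) → Set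
Coding code = Injective _≡_ _≡_ code

-- least t ≤ b (searching t = k, k+1, …, b) with p t = true; returns b if none.
-- searchFrom fuel k b p  with fuel = b + 1 ∸ k
searchFrom : ℕ → ℕ → ℕ → (ℕ → Bool) → ℕ
searchFrom zero    k b p = b
searchFrom (suc f) k b p = if p k then k else searchFrom f (suc k) b p

-- μ t ≤ |ρ| . φ_e^{ρ↾t}(e)↓   (only used when φ_e^ρ(e)↓, so such t exists)
μuse : (ℕ → List ℕ → Bool) → ℕ → List ℕ → ℕ
μuse Φ e ρ = searchFrom (suc (length ρ)) 0 (length ρ) (λ t → Φ e (take t ρ))

nextT : (ℕ → List ℕ → Bool) → List ℕ → ℕ → ℕ → ℕ
nextT Φ ρ i prev = if Φ i ρ then suc prev ⊔ μuse Φ i ρ else suc prev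

-- emits code(ρ↾t_i), code(ρ↾t_{i+1}), … as long as t_j ≤ |ρ|
-- (fuel suffices since t_i ≥ i + 2)
Jgo : (ℕ → List ℕ → Bool) → (List ℕ → ℕ) → List ℕ → ℕ → ℕ → ℕ → List ℕ
Jgo Φ code ρ zero    i prev = []
Jgo Φ code ρ (suc f) i prev =
  let t = nextT Φ ρ i prev in
  if t ≤ᵇ length ρ then code (take t ρ) ∷ Jgo Φ code ρ f (suc i) t else []

-- The jump approximation J (t_{-1} = 1).
J : (ℕ → List ℕ → Bool) → (List ℕ → ℕ) → List ℕ → List ℕ
J Φ code ρ = Jgo Φ code ρ (length ρ) 0 1

Jⁿ : (ℕ → List ℕ → Bool) → (List ℕ → ℕ) → ℕ → List ℕ → List ℕ
Jⁿ Φ code zero    ρ = ρ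
Jⁿ Φ code (suc n) ρ = J Φ code (Jⁿ Φ code n ρ)

Jωgo : (ℕ → List ℕ → Bool) → (List ℕ → ℕ) → ℕ → List ℕ → List ℕ
Jωgo Φ code zero    ρ = []
Jωgo Φ code (suc f) ρ with J Φ code ρ
... | []    = []
... | x ∷ _ = x ∷ Jωgo Φ code f (J Φ code ρ)

-- The ω-jump approximation (fuel suffices since |J(ρ)| < |ρ| for ρ ≠ ⟨⟩).
Jω : (ℕ → List ℕ → Bool) → (List ℕ → ℕ) → List ℕ → List ℕ
Jω Φ code σ = Jωgo Φ code (suc (length σ)) σ

module Submission where

-- J ρ lists the codes of initial segments of ρ, the last one being the code of ρ itself whenever
-- |ρ| ≥ 2 (exactly when J ρ ≠ ⟨⟩). As the coding is injective, J ρ ⊑ J ρ′ with J ρ ≠ ⟨⟩ forces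
-- ρ ⊑ ρ′, so prefix agreement propagates from each level of the jump hierarchy down to the one
-- below. The last nonempty level Jᵏ σ is a singleton, and its entry is the last entry of Jω σ;
-- so Jω σ ⊑ Jω τ gives Jᵏ σ ⊑ Jᵏ τ, and descending yields every level. Conversely the entries
-- of Jω are the heads of the levels. Lengths drop along the hierarchy, so Jω never runs out of fuel.

open import Defs
open import Data.Nat using (ℕ; zero; suc; _+_; _∸_; _≤ᵇ_; _≤_; _<_; z≤n; s≤s)
open import Data.Nat.Properties
open import Data.Bool using (Bool; true; false)
open import Data.List using (List; []; _∷_; take; drop; length)
open import Data.List.Properties using (take++drop≡id; take-all)
open import Data.List.Relation.Unary.All as All using (All; []; _∷_)
open import Data.List.Relation.Unary.Any using (here; there)
open import Data.List.Membership.Propositional using (_∈_)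
open import Data.List.Membership.Propositional.Properties using (∈-++⁺ˡ)
open import Data.List.Relation.Binary.Prefix.Heterogeneous using ([]; _∷_)
open import Data.List.Relation.Binary.Prefix.Heterogeneous.Properties using (length-mono)
open import Data.List.Relation.Binary.Prefix.Propositional.Properties using (Prefix-as-∣ˡ; ∣ˡ-as-Prefix)
open import Data.Product using (∃-syntax; _,_)
open import Data.Sum using (inj₁; inj₂)
open import Data.Empty using (⊥-elim)
open import Relation.Binary.PropositionalEquality using (_≡_; _≢_; refl; sym; cong; subst; subst₂)
open import Function.Bundles using (_⇔_; mk⇔)

searchFrom-≤ : ∀ f k b p → k + f ≤ suc b → searchFrom f k b p ≤ b
searchFrom-≤ zero    k b p _ = ≤-refl
searchFrom-≤ (suc f) k b p k+f<1+b rewrite +-suc k f with p k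
... | true  = ≤-trans (m≤m+n k f) (≤-pred k+f<1+b)
... | false = searchFrom-≤ f (suc k) b p k+f<1+b

take-⊑ : ∀ t (ρ : List ℕ) → take t ρ ⊑ ρ
take-⊑ t ρ = ∣ˡ-as-Prefix record { quotient = drop t ρ ; equality = take++drop≡id t ρ }

∈-resp-⊑ : ∀ {x : ℕ} {α β} → α ⊑ β → x ∈ α → x ∈ β
∈-resp-⊑ α⊑β x∈α with Prefix-as-∣ˡ α⊑β
... | record { equality = refl } = ∈-++⁺ˡ x∈α

module _ (Φ : ℕ → List ℕ → Bool) where

  μuse≤length : ∀ e ρ → μuse Φ e ρ ≤ length ρ
  μuse≤length e ρ = searchFrom-≤ (suc (length ρ)) 0 (length ρ) _ ≤-refl

  suc≤nextT : ∀ ρ i prev → suc prev ≤ nextT Φ ρ i prev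
  suc≤nextT ρ i prev with Φ i ρ
  ... | true  = m≤m⊔n (suc prev) (μuse Φ i ρ)
  ... | false = ≤-refl

  nextT≤length : ∀ ρ i prev → prev < length ρ → nextT Φ ρ i prev ≤ length ρ
  nextT≤length ρ i prev prev<ρ with Φ i ρ
  ... | true  = ⊔-lub prev<ρ (μuse≤length i ρ)
  ... | false = prev<ρ

module JumpHierarchy (Φ : ℕ → List ℕ → Bool) (code : List ℕ → ℕ) where

  private
    Ĵ : List ℕ → List ℕ
    Ĵ = J Φ code

    Ĵⁿ : ℕ → List ℕ → List ℕ
    Ĵⁿ = Jⁿ Φ code

    Ĵωgo : ℕ → List ℕ → List ℕ
    Ĵωgo = Jωgo Φ code

  CodeOfPrefix : List ℕ → ℕ → Set
  CodeOfPrefix ρ x = ∃[ t ] x ≡ code (take t ρ)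

  Jgo-codesOfPrefixes : ∀ ρ f i prev → All (CodeOfPrefix ρ) (Jgo Φ code ρ f i prev)
  Jgo-codesOfPrefixes ρ zero    i prev = []
  Jgo-codesOfPrefixes ρ (suc f) i prev with nextT Φ ρ i prev ≤ᵇ length ρ
  ... | false = []
  ... | true  = (_ , refl) ∷ Jgo-codesOfPrefixes ρ f (suc i) (nextT Φ ρ i prev)

  length-Jgo≤length∸prev : ∀ ρ f i prev → length (Jgo Φ code ρ f i prev) ≤ length ρ ∸ prev
  length-Jgo≤length∸prev ρ zero    i prev = z≤n
  length-Jgo≤length∸prev ρ (suc f) i prev
    with nextT Φ ρ i prev ≤ᵇ length ρ | ≤ᵇ⇒≤ (nextT Φ ρ i prev) (length ρ)
  ... | false | _   = z≤n
  ... | true  | t≤ρ = ≤-trans (s≤s (length-Jgo≤length∸prev ρ f (suc i) _))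
                              (∸-monoʳ-< (suc≤nextT Φ ρ i prev) (t≤ρ _))

  code∈Jgo : ∀ ρ f i prev → prev < length ρ → length ρ ≤ prev + f → code ρ ∈ Jgo Φ code ρ f i prev
  code∈Jgo ρ zero i prev prev<ρ ρ≤prev+0 rewrite +-identityʳ prev = ⊥-elim (<⇒≱ prev<ρ ρ≤prev+0)
  code∈Jgo ρ (suc f) i prev prev<ρ ρ≤prev+1+f
    with nextT Φ ρ i prev | nextT≤length Φ ρ i prev prev<ρ | suc≤nextT Φ ρ i prev
  ... | t | t≤ρ | prev<t with t ≤ᵇ length ρ | ≤⇒≤ᵇ t≤ρ | m≤n⇒m<n∨m≡n t≤ρ
  ...   | false | ()  | _
  ...   | true  | _   | inj₂ refl = here (cong code (sym (take-all (length ρ) ρ ≤-refl)))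
  ...   | true  | _   | inj₁ t<ρ  = there (code∈Jgo ρ f (suc i) t t<ρ ρ≤t+f)
    where
    ρ≤t+f : length ρ ≤ t + f
    ρ≤t+f = ≤-trans ρ≤prev+1+f (subst (_≤ t + f) (sym (+-suc prev f)) (+-monoˡ-≤ f prev<t))

  length-J≤length∸1 : ∀ ρ → length (Ĵ ρ) ≤ length ρ ∸ 1
  length-J≤length∸1 ρ = length-Jgo≤length∸prev ρ (length ρ) 0 1

  code∈J : ∀ ρ → 2 ≤ length ρ → code ρ ∈ Ĵ ρ
  code∈J ρ 2≤ρ = code∈Jgo ρ (length ρ) 0 1 2≤ρ (n≤1+n (length ρ))

  J≢[]⇒2≤length : ∀ ρ → Ĵ ρ ≢ [] → 2 ≤ length ρ
  J≢[]⇒2≤length ρ J≢[] with Ĵ ρ | length-J≤length∸1 ρ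
  ... | []    | _     = ⊥-elim (J≢[] refl)
  ... | _ ∷ _ | 1≤ρ∸1 = m∸n≢0⇒n<m (m<n⇒n≢0 1≤ρ∸1)

  2≤length⇒J≢[] : ∀ ρ → 2 ≤ length ρ → Ĵ ρ ≢ []
  2≤length⇒J≢[] ρ 2≤ρ J≡[] with subst (code ρ ∈_) J≡[] (code∈J ρ 2≤ρ)
  ... | ()

  J-reflects-⊑ : Coding code → ∀ {ρ ρ′} → Ĵ ρ ≢ [] → Ĵ ρ ⊑ Ĵ ρ′ → ρ ⊑ ρ′
  J-reflects-⊑ code-inj {ρ} {ρ′} J≢[] Jρ⊑Jρ′
    with All.lookup (Jgo-codesOfPrefixes ρ′ (length ρ′) 0 1)
                    (∈-resp-⊑ Jρ⊑Jρ′ (code∈J ρ (J≢[]⇒2≤length ρ J≢[])))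
  ... | t , ρ≡take = subst (_⊑ ρ′) (sym (code-inj ρ≡take)) (take-⊑ t ρ′)

  J-reflects-⊑-∷ : Coding code → ∀ x xs ys → Ĵ (x ∷ xs) ⊑ Ĵ (x ∷ ys) → (x ∷ xs) ⊑ (x ∷ ys)
  J-reflects-⊑-∷ code-inj x []       ys _   = refl ∷ []
  J-reflects-⊑-∷ code-inj x (z ∷ zs) ys J⊑J =
    J-reflects-⊑ code-inj (2≤length⇒J≢[] (x ∷ z ∷ zs) (s≤s (s≤s z≤n))) J⊑J

  Ĵⁿ-[] : ∀ n → Ĵⁿ n [] ≡ []
  Ĵⁿ-[] zero    = refl
  Ĵⁿ-[] (suc n) = cong Ĵ (Ĵⁿ-[] n)

  Ĵⁿ-Ĵ : ∀ n ρ → Ĵⁿ n (Ĵ ρ) ≡ Ĵⁿ (suc n) ρ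
  Ĵⁿ-Ĵ zero    ρ = refl
  Ĵⁿ-Ĵ (suc n) ρ = cong Ĵ (Ĵⁿ-Ĵ n ρ)

  _⊑ᴶ_ : List ℕ → List ℕ → Set
  ρ ⊑ᴶ ρ′ = ∀ n → Ĵⁿ n ρ ⊑ Ĵⁿ n ρ′

  []⊑ᴶ : ∀ ρ → [] ⊑ᴶ ρ
  []⊑ᴶ ρ n = subst (_⊑ Ĵⁿ n ρ) (sym (Ĵⁿ-[] n)) []

  ⊑ᴶ-Ĵ : ∀ {ρ ρ′} → ρ ⊑ᴶ ρ′ → Ĵ ρ ⊑ᴶ Ĵ ρ′
  ⊑ᴶ-Ĵ {ρ} {ρ′} ρ⊑ᴶρ′ n = subst₂ _⊑_ (sym (Ĵⁿ-Ĵ n ρ)) (sym (Ĵⁿ-Ĵ n ρ′)) (ρ⊑ᴶρ′ (suc n))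

  ⊑ᴶ-intro : ∀ {ρ ρ′} → ρ ⊑ ρ′ → Ĵ ρ ⊑ᴶ Ĵ ρ′ → ρ ⊑ᴶ ρ′
  ⊑ᴶ-intro         ρ⊑ρ′ _      zero    = ρ⊑ρ′
  ⊑ᴶ-intro {ρ} {ρ′} _    Jρ⊑ᴶJρ′ (suc n) = subst₂ _⊑_ (Ĵⁿ-Ĵ n ρ) (Ĵⁿ-Ĵ n ρ′) (Jρ⊑ᴶJρ′ n)

  -- Level 0 is out of reach here: when J ρ = ⟨⟩ the sequence Jω ρ carries no information on ρ.
  Jωgo-⊑⇒J-⊑ᴶ : Coding code → ∀ {f f′ ρ ρ′} → length ρ ≤ f → Ĵωgo f ρ ⊑ Ĵωgo f′ ρ′ → Ĵ ρ ⊑ᴶ Ĵ ρ′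
  Jωgo-⊑⇒J-⊑ᴶ code-inj {zero}  {ρ = []} _ _ = []⊑ᴶ _
  Jωgo-⊑⇒J-⊑ᴶ code-inj {suc f} {zero} {ρ} _ ω⊑ω with Ĵ ρ | ω⊑ω
  ... | []    | _  = []⊑ᴶ _
  ... | _ ∷ _ | ()
  Jωgo-⊑⇒J-⊑ᴶ code-inj {suc f} {suc f′} {ρ} {ρ′} ρ≤1+f ω⊑ω with Ĵ ρ in Jρ≡ | Ĵ ρ′ in Jρ′≡ | ω⊑ω
  ... | []     | _       | _            = []⊑ᴶ _
  ... | _ ∷ _  | []      | ()
  ... | x ∷ xs | .x ∷ ys | refl ∷ tail⊑ =
    ⊑ᴶ-intro (J-reflects-⊑-∷ code-inj x xs ys (JJρ⊑ᴶJJρ′ 0)) JJρ⊑ᴶJJρ′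
    where
    JJρ⊑ᴶJJρ′ : Ĵ (x ∷ xs) ⊑ᴶ Ĵ (x ∷ ys)
    JJρ⊑ᴶJJρ′ = subst₂ (λ α β → Ĵ α ⊑ᴶ Ĵ β) Jρ≡ Jρ′≡
      (Jωgo-⊑⇒J-⊑ᴶ code-inj {f′ = f′} {ρ′ = Ĵ ρ′} (≤-trans (length-J≤length∸1 ρ) (∸-monoˡ-≤ 1 ρ≤1+f)) tail⊑)

  ⊑ᴶ⇒Jωgo-⊑ : ∀ {f f′ ρ ρ′} → f ≤ f′ → ρ ⊑ᴶ ρ′ → Ĵωgo f ρ ⊑ Ĵωgo f′ ρ′
  ⊑ᴶ⇒Jωgo-⊑ {zero} _ _ = []
  ⊑ᴶ⇒Jωgo-⊑ {suc f} {suc f′} {ρ} {ρ′} (s≤s f≤f′) ρ⊑ᴶρ′ with Ĵ ρ | Ĵ ρ′ | ρ⊑ᴶρ′ 1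
  ... | []    | _     | _       = []
  ... | _ ∷ _ | []    | ()
  ... | _ ∷ _ | _ ∷ _ | x≡y ∷ _ = x≡y ∷ ⊑ᴶ⇒Jωgo-⊑ f≤f′ (⊑ᴶ-Ĵ ρ⊑ᴶρ′)

  Jωgo≢[]⇒J≢[] : ∀ f ρ → Ĵωgo f ρ ≢ [] → Ĵ ρ ≢ []
  Jωgo≢[]⇒J≢[] zero    ρ ω≢[] _ = ω≢[] refl
  Jωgo≢[]⇒J≢[] (suc f) ρ ω≢[] J≡[] with Ĵ ρ | J≡[]
  ... | _ | refl = ω≢[] refl

lemma6p8 : (Φ : ℕ → List ℕ → Bool) → Monotone Φ →
           (code : List ℕ → ℕ) → Coding code →
           (σ τ : List ℕ) → Jω Φ code σ ≢ [] →
           (Jω Φ code σ ⊑ Jω Φ code τ) ⇔ (∀ n → Jⁿ Φ code n σ ⊑ Jⁿ Φ code n τ)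
lemma6p8 Φ _ code code-inj σ τ Jωσ≢[] = mk⇔ to from
  where
  open JumpHierarchy Φ code

  Jσ≢[] : J Φ code σ ≢ []
  Jσ≢[] = Jωgo≢[]⇒J≢[] (suc (length σ)) σ Jωσ≢[]

  to : Jω Φ code σ ⊑ Jω Φ code τ → σ ⊑ᴶ τ
  to ω⊑ω = ⊑ᴶ-intro (J-reflects-⊑ code-inj Jσ≢[] (Jσ⊑ᴶJτ 0)) Jσ⊑ᴶJτ
    where
    Jσ⊑ᴶJτ : J Φ code σ ⊑ᴶ J Φ code τ
    Jσ⊑ᴶJτ = Jωgo-⊑⇒J-⊑ᴶ code-inj (n≤1+n (length σ)) ω⊑ω

  from : σ ⊑ᴶ τ → Jω Φ code σ ⊑ Jω Φ code τ
  from σ⊑ᴶτ = ⊑ᴶ⇒Jωgo-⊑ (s≤s (length-mono (σ⊑ᴶτ 0))) σ⊑ᴶτ
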